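{- For all integers $k$ and $\ell$ with $\ell\le k/10$, the 1-subdivision of an elementary $k\times k$ cylindrical wall is $(100\ell^2,\ell)$-unbreakable.
   Context: An elementary wall of height $h$ and width $w$ consists of $h$ disjoint paths $P_1,\dots,P_h$, each $P_i$ on vertices $v_{i,1},\dots,v_{i,2w}$ in this order, and additionally, for odd $1\le i<h$, edges $v_{i,2j-1}v_{i+1,2j-1}$ for $1\le j\le w$, and for even $1\le i<h$, edges $v_{i,2j}v_{i+1,2j}$ for $1\le j\le w$. An elementary cylindrical wall of height $h$ and width $w$ is obtained from it by adding the edges $v_{i,2w}v_{i,1}$ for $1\le i\le h$; a $k\times k$ one has width and height $k$. The 1-subdivision of a graph replaces every edge by a path of length 2. A separation of $G$ is a pair $(A,B)$ with $A\cup B=V(G)$ and no edge between $A\setminus B$ and $B\setminus A$, of order $|A\cap B|$; $G$ is $(q,k)$-unbreakable if every separation of order at most $k$ satisfies $|A|\le q$ or $|B|\le q$. -}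

module Defs where

open import Data.Nat using (ℕ; zero; suc; _+_; _*_; _<_; _%_)
open import Data.Fin using (Fin; toℕ)
open import Data.Bool using (Bool; true)
open import Data.Product using (Σ; _×_)
open import Data.Sum using (_⊎_; inj₁; inj₂)
open import Data.Empty using (⊥)
open import Relation.Nullary using (¬_)
open import Relation.Binary.PropositionalEquality using (_≡_)
open import Function.Bundles using (_↣_)

record Graph : Set₁ where
  field
    V   : Set
    Adj : V → V → Set
open Graph public

-- Subsets of the vertex set are Boolean predicates; membership is
-- "A v ≡ true" (proof-irrelevant).
Subset : Set → Set
Subset V = V → Bool

_∈ₛ_ : {V : Set} → V → Subset V → Set
v ∈ₛ A = A v ≡ true

AtMost : {V : Set} → (V → Set) → ℕ → Set
AtMost {V} P q = Σ V P ↣ Fin q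

IsSeparation : (G : Graph) → Subset (V G) → Subset (V G) → Set
IsSeparation G A B =
  (∀ v → (v ∈ₛ A) ⊎ (v ∈ₛ B)) ×
  (∀ u v → Adj G u v →
     ¬ ((u ∈ₛ A) × ¬ (u ∈ₛ B) × (v ∈ₛ B) × ¬ (v ∈ₛ A)))

Unbreakable : Graph → ℕ → ℕ → Set
Unbreakable G q k =
  (A B : Subset (V G)) → IsSeparation G A B →
  AtMost (λ v → (v ∈ₛ A) × (v ∈ₛ B)) k →
  AtMost (λ v → v ∈ₛ A) q ⊎ AtMost (λ v → v ∈ₛ B) q

-- Elementary cylindrical wall of height h and width w (0-indexed:
-- vertex (i , j) is the paper's v_{i+1, j+1}, i < h, j < 2w).

WVertex : ℕ → ℕ → Set
WVertex h w = Fin h × Fin (2 * w)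

data WEdge (h w : ℕ) : Set where
  hpath : (i : Fin h) (j : Fin (2 * w)) → suc (toℕ j) < 2 * w → WEdge h w
  hcyc  : (i : Fin h) → WEdge h w
  -- vertical edge v_{i,j} v_{i+1,j}, present iff i and j have the same
  -- parity (paper: odd rows use odd columns, even rows even columns)
  ver   : (i : Fin h) (j : Fin (2 * w)) → suc (toℕ i) < h →
          toℕ i % 2 ≡ toℕ j % 2 → WEdge h w

Incident : {h w : ℕ} → WEdge h w → WVertex h w → Set
Incident (hpath i j _) (a Data.Product., b) =
  a ≡ i × (toℕ b ≡ toℕ j ⊎ toℕ b ≡ suc (toℕ j))
Incident {h} {w} (hcyc i) (a Data.Product., b) =
  a ≡ i × (toℕ b ≡ 0 ⊎ suc (toℕ b) ≡ 2 * w)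
Incident (ver i j _ _) (a Data.Product., b) =
  b ≡ j × (toℕ a ≡ toℕ i ⊎ toℕ a ≡ suc (toℕ i))

SubdivCylWall : ℕ → ℕ → Graph
SubdivCylWall h w = record { V = WVertex h w ⊎ WEdge h w ; Adj = adj }
  where
  adj : WVertex h w ⊎ WEdge h w → WVertex h w ⊎ WEdge h w → Set
  adj (inj₁ v) (inj₁ u) = ⊥
  adj (inj₁ v) (inj₂ e) = Incident e v
  adj (inj₂ e) (inj₁ v) = Incident e v
  adj (inj₂ e) (inj₂ f) = ⊥

-- Rows and columns of the wall (a column being two adjacent node columns with
-- the subdivision vertices between them) are k disjoint connected sets each, and every row
-- meets every column. A separator of size ℓ < k misses some row and some column; their
-- union lies on one side, say A ∖ B, and then so does every separator-free row or column.
-- Every vertex v of B ∖ A is equal or adjacent to a node whose row and column therefore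
-- both meet the separator, and v is determined by one separator vertex on each of them
-- together with one of 8 local types. Hence |B| ≤ ℓ + 8ℓ² ≤ 100ℓ².
module Submission where

open import Defs
open import Level using (0ℓ)
open import Data.Nat using (ℕ; zero; suc; _+_; _*_; _≤_; _<_; _%_; z≤n; s≤s; z<s; _<?_; _≟_)
open import Data.Nat.Properties using (m≤m+n; +-suc; *-comm; <-irrelevant; ≡-irrelevant; <-≤-trans; m<m*n; m≤m*n; +-monoˡ-≤; *-monoˡ-≤; module ≤-Reasoning)
open import Data.Nat.DivMod using (_mod_; %-remove-+ˡ; m<n⇒m%n≡m)
open import Data.Nat.Divisibility using (m∣m*n)
open import Data.Fin using (Fin; zero; suc; #_; toℕ; inject₁; inject≤; cast; combine; remQuot)
open import Data.Fin.Properties as Fin using (any?; all?; ¬∀⟶∃¬; pigeonhole; toℕ<n; toℕ-fromℕ<; toℕ-inject₁; toℕ-cast; toℕ-combine; cast-involutive; remQuot-combine; combine-remQuot; combine-injective; inject≤-injective; +↔⊎; *↔×; <-irrefl)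
open import Data.Fin.Induction using (<-weakInduction)
open import Data.Bool using (Bool; true; false) renaming (_≟_ to _≟ᵇ_)
open import Data.Bool.Properties using (not-¬)
open import Data.Product using (Σ; ∃; _×_; _,_; proj₁; proj₂; uncurry)
open import Data.Product.Properties using (×-≡,≡→≡)
open import Data.Product.Function.NonDependent.Propositional using (_×-↔_)
open import Data.Sum using (_⊎_; inj₁; inj₂; [_,_]′; map)
open import Data.Sum.Properties using (inj₁-injective; inj₂-injective)
open import Data.Sum.Function.Propositional using (_⊎-↔_)
open import Data.Empty using (⊥; ⊥-elim)
open import Function using (_∘_; id)
open import Function.Bundles using (_↣_; mk↣; Injection)
open import Function.Construct.Composition using (_↣-∘_; _↔-∘_)
open import Function.Construct.Identity using (↔-id)
open import Function.Construct.Symmetry using (↔-sym)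
open import Function.Properties.Inverse using (↔⇒↣)
open import Relation.Nullary using (¬_; Dec; yes; no; Irrelevant; contradiction)
open import Relation.Nullary.Decidable using (map′; _×-dec_; _⊎-dec_)
open import Relation.Unary using (Pred; Decidable; Empty; Satisfiable; _∩_)
open import Relation.Unary.Properties using (_∩?_)
open import Relation.Binary.PropositionalEquality using (_≡_; refl; sym; trans; cong; cong₂; subst; module ≡-Reasoning)
import Axiom.UniquenessOfIdentityProofs as UIP

Searchable : Set → Set₁
Searchable A = ∀ (P : Pred A 0ℓ) → Decidable P → Dec (∃ P)

searchable-Fin : ∀ {n} → Searchable (Fin n)
searchable-Fin P = any?

searchable-Σ : {A : Set} {B : A → Set} →
               Searchable A → (∀ a → Searchable (B a)) → Searchable (Σ A B)
searchable-Σ sA sB P P? =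
  map′ (λ (a , b , p) → (a , b) , p) (λ ((a , b) , p) → a , b , p)
       (sA _ λ a → sB a _ λ b → P? (a , b))

searchable-⊎ : {A B : Set} → Searchable A → Searchable B → Searchable (A ⊎ B)
searchable-⊎ sA sB P P? =
  map′ [ (λ (a , p) → inj₁ a , p) , (λ (b , p) → inj₂ b , p) ]′ split
       (sA _ (P? ∘ inj₁) ⊎-dec sB _ (P? ∘ inj₂))
  where
  split : ∃ P → ∃ (P ∘ inj₁) ⊎ ∃ (P ∘ inj₂)
  split (inj₁ a , p) = inj₁ (a , p)
  split (inj₂ b , p) = inj₂ (b , p)

searchable-proposition : {A : Set} → Dec A → Irrelevant A → Searchable A
searchable-proposition (no ¬a) _ P P? = no (¬a ∘ proj₁)
searchable-proposition (yes a) irr P P? =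
  map′ (a ,_) (λ (a′ , p) → subst P (irr a′ a) p) (P? a)

searchable-image : {A B : Set} → Searchable A → (f : A → B) →
                   (∀ b → ∃ λ a → f a ≡ b) → Searchable B
searchable-image sA f onto P P? =
  map′ (λ (a , p) → f a , p)
       (λ (b , p) → proj₁ (onto b) , subst P (sym (proj₂ (onto b))) p)
       (sA (P ∘ f) (P? ∘ f))

satisfiable-or-empty : {A : Set} → Searchable A →
                       {P : Pred A 0ℓ} → Decidable P → Satisfiable P ⊎ Empty P
satisfiable-or-empty search P? with search _ P?
... | yes witness = inj₁ witness
... | no none     = inj₂ λ x p → none (x , p)

pigeonhole-avoid : {A : Set} → Searchable A →
                   ∀ {k ℓ} {L : Fin k → Pred A 0ℓ} {X : Pred A 0ℓ} →
                   (∀ i → Decidable (L i)) → Decidable X →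
                   (∀ {i j x} → L i x → L j x → i ≡ j) →
                   Σ A X ↣ Fin ℓ → ℓ < k → ∃ λ i → Empty (L i ∩ X)
pigeonhole-avoid search {k} {L = L} {X} L? X? disjoint f ℓ<k
  with all? (λ i → search _ (L? i ∩? X?))
... | no ¬all =
  let (i , ¬meets) = ¬∀⟶∃¬ k _ (λ i → search _ (L? i ∩? X?)) ¬all
  in i , λ x p → ¬meets (x , p)
... | yes meets
  with pigeonhole ℓ<k (λ i → Injection.to f (proj₁ (meets i) , proj₂ (proj₂ (meets i))))
... | i , j , i<j , same =
  contradiction i<j (<-irrefl (disjoint (on-line i) (subst (L j) (sym same-point) (on-line j))))
  where
  point : Fin k → _
  point i = proj₁ (meets i)
  on-line : ∀ i → L i (point i)
  on-line i = proj₁ (proj₂ (meets i))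
  same-point : point i ≡ point j
  same-point = cong proj₁ (Injection.injective f same)

Closed : (G : Graph) → Pred (V G) 0ℓ → Pred (V G) 0ℓ → Set
Closed G L P = ∀ {u v} → L u → L v → Adj G u v → P u → P v

Connected : (G : Graph) → Pred (V G) 0ℓ → Set₁
Connected G L = ∀ P → Closed G L P → ∀ {u v} → L u → L v → P u → P v

_∖ₛ_ : {V : Set} → Subset V → Subset V → Pred V 0ℓ
(A ∖ₛ B) v = v ∈ₛ A × B v ≡ false

_∩ₛ_ : {V : Set} → Subset V → Subset V → Pred V 0ℓ
(A ∩ₛ B) v = v ∈ₛ A × v ∈ₛ B

module _ {G : Graph} {A B : Subset (V G)} (sep : IsSeparation G A B) where

  separation-trichotomy : ∀ v → (A ∖ₛ B) v ⊎ (A ∩ₛ B) v ⊎ (B ∖ₛ A) v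
  separation-trichotomy v with A v in av | B v in bv
  ... | true  | false = inj₁ (refl , refl)
  ... | true  | true  = inj₂ (inj₁ (refl , refl))
  ... | false | true  = inj₂ (inj₂ (refl , refl))
  ... | false | false = ⊥-elim ([ not-¬ av , not-¬ bv ]′ (proj₁ sep v))

  separation-edge : ∀ {u v} → Adj G u v → (A ∖ₛ B) u → ¬ (B ∖ₛ A) v
  separation-edge adj (au , bu) (bv , av) = proj₂ sep _ _ adj (au , not-¬ bu , bv , not-¬ av)

  separation-step : ∀ {u v} → Adj G u v → (A ∖ₛ B) u → ¬ (A ∩ₛ B) v → (A ∖ₛ B) v
  separation-step {v = v} adj onlyA ¬shared with separation-trichotomy v
  ... | inj₁ onlyA′         = onlyA′
  ... | inj₂ (inj₁ shared)  = contradiction shared ¬shared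
  ... | inj₂ (inj₂ onlyB)   = contradiction onlyB (separation-edge adj onlyA)

  separation-connected : ∀ {L} → Connected G L → Empty (L ∩ (A ∩ₛ B)) →
                         ∀ {u v} → L u → L v → (A ∖ₛ B) u → (A ∖ₛ B) v
  separation-connected connected clean =
    connected _ λ _ Lv adj onlyA → separation-step adj onlyA λ shared → clean _ (Lv , shared)

separation-swap : {G : Graph} → (∀ {u v} → Adj G u v → Adj G v u) →
                  {A B : Subset (V G)} → IsSeparation G A B → IsSeparation G B A
separation-swap adj-sym (cover , no-edge) =
  (λ v → [ inj₂ , inj₁ ]′ (cover v)) ,
  λ u v adj (bu , ¬au , av , ¬bv) → no-edge v u (adj-sym adj) (av , ¬bv , bu , ¬au)

record Grid (G : Graph) (k t : ℕ) : Set₁ where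
  field
    Row Col               : Fin k → Pred (V G) 0ℓ
    row?                  : ∀ i → Decidable (Row i)
    col?                  : ∀ i → Decidable (Col i)
    rows-disjoint         : ∀ {i j v} → Row i v → Row j v → i ≡ j
    cols-disjoint         : ∀ {i j v} → Col i v → Col j v → i ≡ j
    row-connected         : ∀ i → Connected G (Row i)
    col-connected         : ∀ i → Connected G (Col i)
    crossing              : ∀ i j → ∃ λ v → Row i v × Col j v
    rowOf colOf           : V G → Fin k
    tag                   : V G → Fin t
    anchor                : V G → V G
    anchor-row            : ∀ v → Row (rowOf v) (anchor v)
    anchor-col            : ∀ v → Col (colOf v) (anchor v)
    anchor-near           : ∀ v → anchor v ≡ v ⊎ Adj G (anchor v) v
    coordinates-injective : ∀ {u v} → rowOf u ≡ rowOf v → colOf u ≡ colOf v →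
                            tag u ≡ tag v → u ≡ v

∩ₛ-decidable : {V : Set} (A B : Subset V) → Decidable (A ∩ₛ B)
∩ₛ-decidable A B v = (A v ≟ᵇ true) ×-dec (B v ≟ᵇ true)

∩ₛ-swap : {V : Set} {A B : Subset V} → Σ V (B ∩ₛ A) ↣ Σ V (A ∩ₛ B)
∩ₛ-swap = mk↣ {to = λ (v , b , a) → v , a , b} λ { refl → refl }

code-injection : ∀ ℓ t → (Fin ℓ ⊎ (Fin ℓ × Fin ℓ) × Fin t) ↣ Fin (ℓ + ℓ * ℓ * t)
code-injection ℓ t =
  ↔⇒↣ (↔-sym +↔⊎ ↔-∘ (↔-id _ ⊎-↔ (↔-sym *↔× ↔-∘ (↔-sym *↔× ×-↔ ↔-id _))))

Bool-≡-irrelevant : {a b : Bool} → Irrelevant (a ≡ b)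
Bool-≡-irrelevant = UIP.Decidable⇒UIP.≡-irrelevant _≟ᵇ_

module _ {G : Graph} {k t : ℕ} (grid : Grid G k t) (search : Searchable (V G)) where
  open Grid grid

  module _ {A B : Subset (V G)} (sep : IsSeparation G A B) {ℓ : ℕ}
           (separator : Σ (V G) (A ∩ₛ B) ↣ Fin ℓ)
           {i j : Fin k} (row-clean : Empty (Row i ∩ (A ∩ₛ B))) (col-clean : Empty (Col j ∩ (A ∩ₛ B)))
           {u : V G} (row-u : Row i u) (col-u : Col j u) (onlyA-u : (A ∖ₛ B) u) where

    private
      Shared : Pred (V G) 0ℓ
      Shared = A ∩ₛ B

      shared? : Decidable Shared
      shared? = ∩ₛ-decidable A B

      index : Σ (V G) Shared → Fin ℓ
      index = Injection.to separator

    -- Through its crossing with the clean column j (resp. row i), every clean row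
    -- (resp. column) lies entirely on the A-side.
    clean-row-onlyA : ∀ {i′} → Empty (Row i′ ∩ Shared) → ∀ {v} → Row i′ v → (A ∖ₛ B) v
    clean-row-onlyA {i′} clean row-v =
      let (x , row-x , col-x) = crossing i′ j
      in separation-connected sep (row-connected i′) clean row-x row-v
           (separation-connected sep (col-connected j) col-clean col-u col-x onlyA-u)

    clean-col-onlyA : ∀ {j′} → Empty (Col j′ ∩ Shared) → ∀ {v} → Col j′ v → (A ∖ₛ B) v
    clean-col-onlyA {j′} clean col-v =
      let (x , row-x , col-x) = crossing i j′
      in separation-connected sep (col-connected j′) clean col-x col-v
           (separation-connected sep (row-connected i) row-clean row-u row-x onlyA-u)

    anchor-not-onlyA : ∀ {v} → (B ∖ₛ A) v → ¬ (A ∖ₛ B) (anchor v)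
    anchor-not-onlyA {v} onlyB with anchor-near v
    ... | inj₁ same = λ (a , _) → not-¬ (proj₂ onlyB) (subst (_∈ₛ A) same a)
    ... | inj₂ adj  = λ onlyA → separation-edge sep adj onlyA onlyB

    row-meets-separator : ∀ {v} → (B ∖ₛ A) v → Satisfiable (Row (rowOf v) ∩ Shared)
    row-meets-separator {v} onlyB with satisfiable-or-empty search (row? (rowOf v) ∩? shared?)
    ... | inj₁ meets = meets
    ... | inj₂ clean = contradiction (clean-row-onlyA clean (anchor-row v)) (anchor-not-onlyA onlyB)

    col-meets-separator : ∀ {v} → (B ∖ₛ A) v → Satisfiable (Col (colOf v) ∩ Shared)
    col-meets-separator {v} onlyB with satisfiable-or-empty search (col? (colOf v) ∩? shared?)
    ... | inj₁ meets = meets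
    ... | inj₂ clean = contradiction (clean-col-onlyA clean (anchor-col v)) (anchor-not-onlyA onlyB)

    private
      Code : Set
      Code = Fin ℓ ⊎ (Fin ℓ × Fin ℓ) × Fin t

      separator-point : ∀ {L : Pred (V G) 0ℓ} → Satisfiable (L ∩ Shared) → Fin ℓ
      separator-point (x , _ , shared) = index (x , shared)

      encode : ∀ v → Shared v ⊎ (B ∖ₛ A) v → Code
      encode v (inj₁ shared) = inj₁ (index (v , shared))
      encode v (inj₂ onlyB)  =
        inj₂ ((separator-point (row-meets-separator onlyB) ,
               separator-point (col-meets-separator onlyB)) , tag v)

      same-line : ∀ {L : Fin k → Pred (V G) 0ℓ} → (∀ {a b x} → L a x → L b x → a ≡ b) →
                  ∀ {a b} (p : Satisfiable (L a ∩ Shared)) (q : Satisfiable (L b ∩ Shared)) →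
                  separator-point p ≡ separator-point q → a ≡ b
      same-line disjoint (x , Lx , sx) (y , Ly , sy) eq
        with refl ← cong proj₁ (Injection.injective separator eq) = disjoint Lx Ly

      encode-injective : ∀ {v w} s s′ → encode v s ≡ encode w s′ → v ≡ w
      encode-injective (inj₁ s) (inj₁ s′) eq =
        cong proj₁ (Injection.injective separator (inj₁-injective eq))
      encode-injective (inj₂ o) (inj₂ o′) eq =
        let e = inj₂-injective eq in
        coordinates-injective
          (same-line rows-disjoint (row-meets-separator o) (row-meets-separator o′) (cong (proj₁ ∘ proj₁) e))
          (same-line cols-disjoint (col-meets-separator o) (col-meets-separator o′) (cong (proj₂ ∘ proj₁) e))
          (cong proj₂ e)
      encode-injective (inj₁ _) (inj₂ _) ()
      encode-injective (inj₂ _) (inj₁ _) ()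

      side : ∀ {v} → v ∈ₛ B → Shared v ⊎ (B ∖ₛ A) v
      side {v} bv with separation-trichotomy sep v
      ... | inj₁ (_ , ¬bv) = contradiction bv (not-¬ ¬bv)
      ... | inj₂ s         = s

    B-small : AtMost (_∈ₛ B) (ℓ + ℓ * ℓ * t)
    B-small = code-injection ℓ t ↣-∘ mk↣ {to = λ (v , bv) → encode v (side bv)} injective
      where
      injective : ∀ {p q} → encode (proj₁ p) (side (proj₂ p)) ≡ encode (proj₁ q) (side (proj₂ q)) → p ≡ q
      injective {v , bv} {w , bw} eq with refl ← encode-injective (side bv) (side bw) eq =
        cong (v ,_) (Bool-≡-irrelevant bv bw)

  grid-unbreakable : (∀ {u v} → Adj G u v → Adj G v u) →
                     ∀ {ℓ} → ℓ < k → Unbreakable G (ℓ + ℓ * ℓ * t) ℓ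
  grid-unbreakable adj-sym {ℓ} ℓ<k A B sep separator
    with pigeonhole-avoid search row? (∩ₛ-decidable A B) rows-disjoint separator ℓ<k
       | pigeonhole-avoid search col? (∩ₛ-decidable A B) cols-disjoint separator ℓ<k
  ... | i , row-clean | j , col-clean
    with crossing i j
  ... | u , row-u , col-u
    with separation-trichotomy sep u
  ... | inj₁ onlyA = inj₂ (B-small sep separator row-clean col-clean row-u col-u onlyA)
  ... | inj₂ (inj₁ shared) = contradiction (row-u , shared) (row-clean u)
  ... | inj₂ (inj₂ onlyB) =
    inj₁ (B-small (separation-swap adj-sym sep) (separator ↣-∘ ∩ₛ-swap)
                  (λ v (Lv , b , a) → row-clean v (Lv , a , b))
                  (λ v (Lv , b , a) → col-clean v (Lv , a , b))
                  row-u col-u onlyB)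

Fin-walk : ∀ {n} (P : Pred (Fin (suc n)) 0ℓ) →
           (∀ i → P (inject₁ i) → P (suc i)) → (∀ i → P (suc i) → P (inject₁ i)) →
           ∀ a b → P a → P b
Fin-walk P up down a b =
  <-weakInduction (λ b → P zero → P b) id (λ i hyp → up i ∘ hyp) b ∘
  <-weakInduction (λ a → P a → P zero) id (λ i hyp → hyp ∘ down i) a

toℕ-suc-inject₁ : ∀ {n} (i : Fin n) → toℕ (suc i) ≡ suc (toℕ (inject₁ i))
toℕ-suc-inject₁ i = cong suc (sym (toℕ-inject₁ i))

suc-inject₁< : ∀ {n} (i : Fin n) → suc (toℕ (inject₁ i)) < suc n
suc-inject₁< {n} i = subst (_< suc n) (toℕ-suc-inject₁ i) (toℕ<n (suc i))

module Halves (k : ℕ) where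

  split : Fin (2 * k) → Fin k × Fin 2
  split b = remQuot 2 (cast (*-comm 2 k) b)

  position : Fin k → Fin 2 → Fin (2 * k)
  position c p = cast (*-comm k 2) (combine c p)

  column : Fin (2 * k) → Fin k
  column = proj₁ ∘ split

  parity : Fin (2 * k) → Fin 2
  parity = proj₂ ∘ split

  split-position : ∀ c p → split (position c p) ≡ (c , p)
  split-position c p =
    trans (cong (remQuot 2) (cast-involutive (*-comm 2 k) (*-comm k 2) (combine c p)))
          (remQuot-combine c p)

  position-split : ∀ b → uncurry position (split b) ≡ b
  position-split b =
    trans (cong (cast (*-comm k 2)) (combine-remQuot {k} 2 (cast (*-comm 2 k) b)))
          (cast-involutive (*-comm k 2) (*-comm 2 k) b)

  split-injective : ∀ {b b′} → split b ≡ split b′ → b ≡ b′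
  split-injective {b} {b′} eq =
    trans (sym (position-split b)) (trans (cong (uncurry position) eq) (position-split b′))

  column-position : ∀ c p → column (position c p) ≡ c
  column-position c p = cong proj₁ (split-position c p)

  parity-position : ∀ c p → parity (position c p) ≡ p
  parity-position c p = cong proj₂ (split-position c p)

  toℕ-position : ∀ c p → toℕ (position c p) ≡ 2 * toℕ c + toℕ p
  toℕ-position c p = trans (toℕ-cast (*-comm k 2) (combine c p)) (toℕ-combine c p)

  position-%2 : ∀ c p → toℕ (position c p) % 2 ≡ toℕ p
  position-%2 c p = begin
    toℕ (position c p) % 2     ≡⟨ cong (_% 2) (toℕ-position c p) ⟩
    (2 * toℕ c + toℕ p) % 2    ≡⟨ %-remove-+ˡ (toℕ p) (m∣m*n (toℕ c)) ⟩
    toℕ p % 2                  ≡⟨ m<n⇒m%n≡m (toℕ<n p) ⟩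
    toℕ p                      ∎
    where open ≡-Reasoning

  toℕ-position-suc : ∀ c → toℕ (position c (suc zero)) ≡ suc (toℕ (position c zero))
  toℕ-position-suc c = begin
    toℕ (position c (suc zero))   ≡⟨ toℕ-position c (suc zero) ⟩
    2 * toℕ c + 1                 ≡⟨ +-suc (2 * toℕ c) 0 ⟩
    suc (2 * toℕ c + 0)           ≡⟨ cong suc (toℕ-position c zero) ⟨
    suc (toℕ (position c zero))   ∎
    where open ≡-Reasoning

module _ {h w : ℕ} where

  private
    Cell = Fin h × Fin (2 * w)

    EdgeCode : Set
    EdgeCode = (Σ Cell (λ (i , j) → suc (toℕ j) < 2 * w) ⊎ Fin h) ⊎
               Σ Cell (λ (i , j) → suc (toℕ i) < h × toℕ i % 2 ≡ toℕ j % 2)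

    decode : EdgeCode → WEdge h w
    decode (inj₁ (inj₁ ((i , j) , p))) = hpath i j p
    decode (inj₁ (inj₂ i))             = hcyc i
    decode (inj₂ ((i , j) , p , q))    = ver i j p q

    decode-onto : ∀ e → ∃ λ c → decode c ≡ e
    decode-onto (hpath i j p) = inj₁ (inj₁ ((i , j) , p)) , refl
    decode-onto (hcyc i)      = inj₁ (inj₂ i) , refl
    decode-onto (ver i j p q) = inj₂ ((i , j) , p , q) , refl

    searchable-Cell : Searchable Cell
    searchable-Cell = searchable-Σ searchable-Fin λ _ → searchable-Fin

    searchable-EdgeCode : Searchable EdgeCode
    searchable-EdgeCode =
      searchable-⊎
        (searchable-⊎
          (searchable-Σ searchable-Cell λ (i , j) →
             searchable-proposition (suc (toℕ j) <? 2 * w) <-irrelevant)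
          searchable-Fin)
        (searchable-Σ searchable-Cell λ (i , j) →
           searchable-Σ (searchable-proposition (suc (toℕ i) <? h) <-irrelevant) λ _ →
             searchable-proposition (toℕ i % 2 ≟ toℕ j % 2) ≡-irrelevant)

  searchable-SubdivCylWall : Searchable (V (SubdivCylWall h w))
  searchable-SubdivCylWall =
    searchable-⊎ searchable-Cell (searchable-image searchable-EdgeCode decode decode-onto)

  SubdivCylWall-sym : ∀ {u v} → Adj (SubdivCylWall h w) u v → Adj (SubdivCylWall h w) v u
  SubdivCylWall-sym {inj₁ _} {inj₂ _} adj = adj
  SubdivCylWall-sym {inj₂ _} {inj₁ _} adj = adj

SubdivCylWall-0-empty : ¬ V (SubdivCylWall 0 0)
SubdivCylWall-0-empty (inj₁ (() , _))
SubdivCylWall-0-empty (inj₂ (hpath () _ _))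
SubdivCylWall-0-empty (inj₂ (hcyc ()))
SubdivCylWall-0-empty (inj₂ (ver () _ _ _))

module CylindricalWall (k′ : ℕ) where

  k : ℕ
  k = suc k′

  Wall : Graph
  Wall = SubdivCylWall k k

  Vertex : Set
  Vertex = V Wall

  open Halves k

  node : Fin k → Fin (2 * k) → Vertex
  node a b = inj₁ (a , b)

  Row : Fin k → Pred Vertex 0ℓ
  Row i (inj₁ (a , _))       = a ≡ i
  Row i (inj₂ (hpath a _ _)) = a ≡ i
  Row i (inj₂ (hcyc _))      = ⊥
  Row i (inj₂ (ver _ _ _ _)) = ⊥

  -- Column c consists of the node columns 2c and 2c+1 and the subdivision vertices inside them.
  Col : Fin k → Pred Vertex 0ℓ
  Col c (inj₁ (_ , b))       = column b ≡ c
  Col c (inj₂ (hpath _ b _)) = column b ≡ c × parity b ≡ zero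
  Col c (inj₂ (hcyc _))      = ⊥
  Col c (inj₂ (ver _ b _ _)) = column b ≡ c

  row? : ∀ i → Decidable (Row i)
  row? i (inj₁ (a , _))       = a Fin.≟ i
  row? i (inj₂ (hpath a _ _)) = a Fin.≟ i
  row? i (inj₂ (hcyc _))      = no λ ()
  row? i (inj₂ (ver _ _ _ _)) = no λ ()

  col? : ∀ c → Decidable (Col c)
  col? c (inj₁ (_ , b))       = column b Fin.≟ c
  col? c (inj₂ (hpath _ b _)) = (column b Fin.≟ c) ×-dec (parity b Fin.≟ zero)
  col? c (inj₂ (hcyc _))      = no λ ()
  col? c (inj₂ (ver _ b _ _)) = column b Fin.≟ c

  rows-disjoint : ∀ {i j v} → Row i v → Row j v → i ≡ j
  rows-disjoint {v = inj₁ _}             refl refl = refl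
  rows-disjoint {v = inj₂ (hpath _ _ _)} refl refl = refl

  cols-disjoint : ∀ {i j v} → Col i v → Col j v → i ≡ j
  cols-disjoint {v = inj₁ _}               refl       refl       = refl
  cols-disjoint {v = inj₂ (hpath _ _ _)}   (refl , _) (refl , _) = refl
  cols-disjoint {v = inj₂ (ver _ _ _ _)}   refl       refl       = refl

  module Along {L P : Pred Vertex 0ℓ} (closed : Closed Wall L P) where

    across : ∀ {x y} e → L (inj₁ x) → L (inj₂ e) → L (inj₁ y) →
             Incident e x → Incident e y → P (inj₁ x) → P (inj₁ y)
    across {x} {y} e Lx Le Ly ex ey =
      closed {inj₂ e} {inj₁ y} Le Ly ey ∘ closed {inj₁ x} {inj₂ e} Lx Le ex

  row-connected : ∀ i → Connected Wall (Row i)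
  row-connected i P closed {u} {v} row-u row-v = from-start v row-v ∘ to-start u row-u
    where
    open Along {Row i} {P} closed

    along : ∀ b b′ → P (node i b) → P (node i b′)
    along = Fin-walk (P ∘ node i)
      (λ j → across (hpath i (inject₁ j) (suc-inject₁< j)) refl refl refl
                    (refl , inj₁ refl) (refl , inj₂ (toℕ-suc-inject₁ j)))
      (λ j → across (hpath i (inject₁ j) (suc-inject₁< j)) refl refl refl
                    (refl , inj₂ (toℕ-suc-inject₁ j)) (refl , inj₁ refl))

    to-start : ∀ u → Row i u → P u → P (node i zero)
    to-start (inj₁ (_ , b))       refl = along b zero
    to-start (inj₂ (hpath _ b p)) refl =
      along b zero ∘ closed {inj₂ (hpath i b p)} {node i b} refl refl (refl , inj₁ refl)

    from-start : ∀ v → Row i v → P (node i zero) → P v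
    from-start (inj₁ (_ , b))       refl = along zero b
    from-start (inj₂ (hpath _ b p)) refl =
      closed {node i b} {inj₂ (hpath i b p)} refl refl (refl , inj₁ refl) ∘ along zero b

  col-connected : ∀ c → Connected Wall (Col c)
  col-connected c P closed {u} {v} col-u col-v = from-start v col-v ∘ to-start u col-u
    where
    open Along {Col c} {P} closed

    cell : Fin k → Fin 2 → Vertex
    cell a p = node a (position c p)

    in-col : ∀ a p → Col c (cell a p)
    in-col a p = column-position c p

    rung-edge : Fin k → WEdge k k
    rung-edge a = hpath a (position c zero)
      (subst (_< 2 * k) (toℕ-position-suc c) (toℕ<n (position c (suc zero))))

    rung-edge-in-col : ∀ a → Col c (inj₂ (rung-edge a))
    rung-edge-in-col a = column-position c zero , parity-position c zero

    rung : ∀ a p p′ → P (cell a p) → P (cell a p′)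
    rung a zero       zero       = id
    rung a (suc zero) (suc zero) = id
    rung a zero       (suc zero) =
      across (rung-edge a) (in-col a zero) (rung-edge-in-col a) (in-col a (suc zero))
             (refl , inj₁ refl) (refl , inj₂ (toℕ-position-suc c))
    rung a (suc zero) zero       =
      across (rung-edge a) (in-col a (suc zero)) (rung-edge-in-col a) (in-col a zero)
             (refl , inj₂ (toℕ-position-suc c)) (refl , inj₁ refl)

    -- The vertical edge leaving row a uses the node column whose parity is that of a.
    rail : Fin k → Fin 2
    rail a = toℕ a mod 2

    rail-parity : ∀ a → toℕ a % 2 ≡ toℕ (position c (rail a)) % 2
    rail-parity a = sym (trans (position-%2 c (rail a)) (toℕ-fromℕ< _))

    vertical : Fin k′ → WEdge k k
    vertical j = ver (inject₁ j) (position c (rail (inject₁ j))) (suc-inject₁< j) (rail-parity (inject₁ j))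

    climb : ∀ a a′ → P (cell a zero) → P (cell a′ zero)
    climb = Fin-walk (λ a → P (cell a zero))
      (λ j → let r = rail (inject₁ j) in
        rung (suc j) r zero ∘
        across (vertical j) (in-col (inject₁ j) r) (column-position c r) (in-col (suc j) r)
               (refl , inj₁ refl) (refl , inj₂ (toℕ-suc-inject₁ j)) ∘
        rung (inject₁ j) zero r)
      (λ j → let r = rail (inject₁ j) in
        rung (inject₁ j) r zero ∘
        across (vertical j) (in-col (suc j) r) (column-position c r) (in-col (inject₁ j) r)
               (refl , inj₂ (toℕ-suc-inject₁ j)) (refl , inj₁ refl) ∘
        rung (suc j) zero r)

    node-cell : ∀ a b → column b ≡ c → node a b ≡ cell a (parity b)
    node-cell a b eq =
      cong (node a) (trans (sym (position-split b)) (cong (λ c′ → position c′ (parity b)) eq))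

    node-to-start : ∀ a b → column b ≡ c → P (node a b) → P (cell zero zero)
    node-to-start a b eq = climb a zero ∘ rung a (parity b) zero ∘ subst P (node-cell a b eq)

    node-from-start : ∀ a b → column b ≡ c → P (cell zero zero) → P (node a b)
    node-from-start a b eq = subst P (sym (node-cell a b eq)) ∘ rung a zero (parity b) ∘ climb zero a

    to-start : ∀ u → Col c u → P u → P (cell zero zero)
    to-start (inj₁ (a , b))       eq          = node-to-start a b eq
    to-start (inj₂ (hpath a b p)) col@(eq , _) =
      node-to-start a b eq ∘ closed {inj₂ (hpath a b p)} {node a b} col eq (refl , inj₁ refl)
    to-start (inj₂ (ver a b p q)) eq          =
      node-to-start a b eq ∘ closed {inj₂ (ver a b p q)} {node a b} eq eq (refl , inj₁ refl)

    from-start : ∀ v → Col c v → P (cell zero zero) → P v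
    from-start (inj₁ (a , b))       eq          = node-from-start a b eq
    from-start (inj₂ (hpath a b p)) col@(eq , _) =
      closed {node a b} {inj₂ (hpath a b p)} eq col (refl , inj₁ refl) ∘ node-from-start a b eq
    from-start (inj₂ (ver a b p q)) eq          =
      closed {node a b} {inj₂ (ver a b p q)} eq eq (refl , inj₁ refl) ∘ node-from-start a b eq

  spot : Vertex → WVertex k k
  spot (inj₁ x)             = x
  spot (inj₂ (hpath a b _)) = a , b
  spot (inj₂ (hcyc a))      = a , zero
  spot (inj₂ (ver a b _ _)) = a , b

  kind : Vertex → Fin 4
  kind (inj₁ _)             = # 0
  kind (inj₂ (hpath _ _ _)) = # 1
  kind (inj₂ (hcyc _))      = # 2
  kind (inj₂ (ver _ _ _ _)) = # 3

  spot-near : ∀ v → inj₁ (spot v) ≡ v ⊎ Adj Wall (inj₁ (spot v)) v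
  spot-near (inj₁ _)             = inj₁ refl
  spot-near (inj₂ (hpath _ _ _)) = inj₂ (refl , inj₁ refl)
  spot-near (inj₂ (hcyc _))      = inj₂ (refl , inj₁ refl)
  spot-near (inj₂ (ver _ _ _ _)) = inj₂ (refl , inj₁ refl)

  spot-kind-injective : ∀ {u v} → spot u ≡ spot v → kind u ≡ kind v → u ≡ v
  spot-kind-injective {inj₁ _}             {inj₁ _}             refl _ = refl
  spot-kind-injective {inj₂ (hpath a b p)} {inj₂ (hpath _ _ p′)} refl _ =
    cong (inj₂ ∘ hpath a b) (<-irrelevant p p′)
  spot-kind-injective {inj₂ (hcyc _)}      {inj₂ (hcyc _)}      refl _ = refl
  spot-kind-injective {inj₂ (ver a b p q)} {inj₂ (ver _ _ p′ q′)} refl _ =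
    cong₂ (λ p q → inj₂ (ver a b p q)) (<-irrelevant p p′) (≡-irrelevant q q′)
  spot-kind-injective {inj₁ _}             {inj₂ (hpath _ _ _)} _ ()
  spot-kind-injective {inj₁ _}             {inj₂ (hcyc _)}      _ ()
  spot-kind-injective {inj₁ _}             {inj₂ (ver _ _ _ _)} _ ()
  spot-kind-injective {inj₂ (hpath _ _ _)} {inj₁ _}             _ ()
  spot-kind-injective {inj₂ (hpath _ _ _)} {inj₂ (hcyc _)}      _ ()
  spot-kind-injective {inj₂ (hpath _ _ _)} {inj₂ (ver _ _ _ _)} _ ()
  spot-kind-injective {inj₂ (hcyc _)}      {inj₁ _}             _ ()
  spot-kind-injective {inj₂ (hcyc _)}      {inj₂ (hpath _ _ _)} _ ()
  spot-kind-injective {inj₂ (hcyc _)}      {inj₂ (ver _ _ _ _)} _ ()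
  spot-kind-injective {inj₂ (ver _ _ _ _)} {inj₁ _}             _ ()
  spot-kind-injective {inj₂ (ver _ _ _ _)} {inj₂ (hpath _ _ _)} _ ()
  spot-kind-injective {inj₂ (ver _ _ _ _)} {inj₂ (hcyc _)}      _ ()

  tag : Vertex → Fin 8
  tag v = combine (kind v) (parity (proj₂ (spot v)))

  grid : Grid Wall k 8
  grid = record
    { Row                   = Row
    ; Col                   = Col
    ; row?                  = row?
    ; col?                  = col?
    ; rows-disjoint         = rows-disjoint
    ; cols-disjoint         = cols-disjoint
    ; row-connected         = row-connected
    ; col-connected         = col-connected
    ; crossing              = λ i c → node i (position c zero) , refl , column-position c zero
    ; rowOf                 = proj₁ ∘ spot
    ; colOf                 = column ∘ proj₂ ∘ spot
    ; tag                   = tag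
    ; anchor                = inj₁ ∘ spot
    ; anchor-row            = λ _ → refl
    ; anchor-col            = λ _ → refl
    ; anchor-near           = spot-near
    ; coordinates-injective = λ {u} {v} same-row same-col same-tag →
        let (same-kind , same-parity) = combine-injective (kind u) _ (kind v) _ same-tag
        in spot-kind-injective
             (×-≡,≡→≡ (same-row , split-injective (×-≡,≡→≡ (same-col , same-parity))))
             same-kind
    }

unbreakable-empty : ∀ {G q ℓ} → ¬ V G → Unbreakable G q ℓ
unbreakable-empty empty _ _ _ _ =
  inj₁ (mk↣ {to = ⊥-elim ∘ empty ∘ proj₁} λ {p} _ → ⊥-elim (empty (proj₁ p)))

unbreakable-mono : ∀ {G q q′ ℓ} → q ≤ q′ → Unbreakable G q ℓ → Unbreakable G q′ ℓ
unbreakable-mono {q = q} {q′} q≤q′ unbreakable A B sep separator =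
  map (widen ↣-∘_) (widen ↣-∘_) (unbreakable A B sep separator)
  where
  widen : Fin q ↣ Fin q′
  widen = mk↣ {to = λ i → inject≤ i q≤q′} (inject≤-injective q≤q′ q≤q′ _ _)

n≤n*n : ∀ n → n ≤ n * n
n≤n*n zero    = z≤n
n≤n*n (suc n) = m≤m*n (suc n) (suc n)

wall-count≤ : ∀ ℓ → ℓ + ℓ * ℓ * 8 ≤ 100 * (ℓ * ℓ)
wall-count≤ ℓ = begin
  ℓ + ℓ * ℓ * 8          ≤⟨ +-monoˡ-≤ (ℓ * ℓ * 8) (n≤n*n ℓ) ⟩
  ℓ * ℓ + ℓ * ℓ * 8      ≡⟨ cong (ℓ * ℓ +_) (*-comm (ℓ * ℓ) 8) ⟩
  ℓ * ℓ + 8 * (ℓ * ℓ)    ≡⟨⟩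
  9 * (ℓ * ℓ)            ≤⟨ *-monoˡ-≤ (ℓ * ℓ) (m≤m+n 9 91) ⟩
  100 * (ℓ * ℓ)          ∎
  where open ≤-Reasoning

10*ℓ≤k⇒ℓ<k : ∀ ℓ k → 10 * ℓ ≤ suc k → ℓ < suc k
10*ℓ≤k⇒ℓ<k zero    k _      = z<s
10*ℓ≤k⇒ℓ<k (suc ℓ) k 10ℓ≤k =
  <-≤-trans (subst (suc ℓ <_) (*-comm (suc ℓ) 10) (m<m*n (suc ℓ) 10 (s≤s (s≤s z≤n)))) 10ℓ≤k

lemma3p20 : (k ℓ : ℕ) → 10 * ℓ ≤ k →
    Unbreakable (SubdivCylWall k k) (100 * (ℓ * ℓ)) ℓ
lemma3p20 zero      ℓ _      = unbreakable-empty SubdivCylWall-0-empty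
lemma3p20 (suc k′) ℓ 10ℓ≤k =
  unbreakable-mono (wall-count≤ ℓ)
    (grid-unbreakable (CylindricalWall.grid k′) searchable-SubdivCylWall
                      (λ {u} {v} → SubdivCylWall-sym {u = u} {v = v})
                      (10*ℓ≤k⇒ℓ<k ℓ k′ 10ℓ≤k))
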